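{- Let $\Delta$ be a 3-colored simplicial complex with $f_{12}(\Delta)\le f_{13}(\Delta)\le f_{23}(\Delta)$, and let $\Gamma_1,\Gamma_2\in\mathcal{F}(\Delta)$ with $g_1(\Gamma_1)=g_1(\Gamma_2)=b_1(\Delta)$ and $r(\Gamma_1)=r(\Gamma_2)=2$. If $x\in\mathbb{Z}$ satisfies $g_2(\Gamma_1)<x<g_2(\Gamma_2)$, then there is a complex $\Gamma_3\in\mathcal{F}(\Delta)$ with $g_2(\Gamma_3)=x$, $g_1(\Gamma_3)=b_1(\Delta)$ and $r(\Gamma_3)=2$.
   Context: A 3-colored simplicial complex is a finite simplicial complex with a coloring of its vertices by $[3]=\{1,2,3\}$ such that no face contains two vertices of the same color. $f_S(\Delta)$ is the number of faces with color set exactly $S\subseteq[3]$ (written $f_1,f_{12},f_{123}$, etc.; $f_{ij}=f_{\{i,j\}}$). Faces with color set $[3]$ are facets. Complexes are assumed to have $f_S>0$ for all $S$. Vertices of color $i$ are labeled $v^i_1,v^i_2,\dots$. Define $b_1(\Delta)=\lfloor\sqrt{f_{12}f_{13}/f_{23}}\rfloor$, $b_2(\Delta)=\lfloor\sqrt{f_{12}f_{23}/f_{13}}\rfloor$, $b_3(\Delta)=\lfloor\sqrt{f_{13}f_{23}/f_{12}}\rfloor$ (all $f$'s of $\Delta$). Construction: given $\Delta$, positive integers $g_1,g_2,g_3$ and distinct $p,q\in[3]$, build $\Gamma$ as follows. Start with vertices $v^i_1,\dots,v^i_{g_i}$ for each $i$, every two of distinct colors adjacent. If $f_p(\Delta)>g_p$,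 add $v^p_{g_p+1}$ and, for each color $c\ne p$, join it to the first $k_c$ present vertices of color $c$, with $k_c$ as large as possible so that the number of edges of color set $\{p,c\}$ does not exceed $f_{pc}(\Delta)$. Then, if $f_q(\Delta)>g_q$, add $v^q_{g_q+1}$ and join it in the same way (the present vertices of color $p$ including $v^p_{g_p+1}$ if added). Faces: empty set, vertices, edges, all triples of pairwise adjacent vertices. Write $g_i(\Gamma),p(\Gamma),q(\Gamma)$ for the parameters and $r(\Gamma)=6-p(\Gamma)-q(\Gamma)$. $\mathcal{A}(\Delta)$ is the set of all complexes (with parameters) so constructed that are well defined and satisfy $f_S(\Gamma)\le f_S(\Delta)$ for all $S\ne[3]$. $m(\Delta)=\max\{f_{123}(\Gamma):\Gamma\in\mathcal{A}(\Delta)\}$; $\mathcal{B}(\Delta)=\{\Gamma\in\mathcal{A}(\Delta):f_{123}(\Gamma)=m(\Delta)\}$; $n(\Delta)=\max\{f_{12}(\Gamma)+f_{13}(\Gamma)+f_{23}(\Gamma):\Gamma\in\mathcal{B}(\Delta)\}$; $\mathcal{C}(\Delta)=\{\Gamma\in\mathcal{B}(\Delta):f_{12}(\Gamma)+f_{13}(\Gamma)+f_{23}(\Gamma)=n(\Delta)\}$; $\mathcal{D}(\Delta)=\{\Gamma\in\mathcal{C}(\Delta): f_{123}(\Gamma)<\min\{f_1(\Delta)f_{23}(\Delta),f_2(\Delta)f_{13}(\Delta),f_3(\Delta)f_{12}(\Delta)\}\}$. $\mathcal{F}(\Delta)$ is the set of $\Gamma$ such that $\Gamma\in\mathcal{A}(\Delta)$,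 $f_{12}(\Gamma)+f_{13}(\Gamma)+f_{23}(\Gamma)=f_{12}(\Delta)+f_{13}(\Delta)+f_{23}(\Delta)$, $\mathcal{D}(\Delta)\neq\emptyset$, and $g_i(\Gamma)=b_i(\Delta)$ for some $i\in[3]$. -}

module Defs where

open import Data.Nat using (ℕ; zero; suc; _+_; _*_; _∸_; _≤_; _<_; _⊓_; _<ᵇ_; _≡ᵇ_)
open import Data.Bool using (Bool; true; false; _∧_; _∨_; not; if_then_else_; T)
open import Data.Maybe using (Maybe; just; nothing; is-just)
open import Data.Fin using (Fin; toℕ)
open import Data.List using (List; []; _∷_; map; allFin)
open import Data.Nat.ListAction using (sum)
open import Data.Product using (Σ; _×_; ∃)
open import Data.Sum using (_⊎_)
open import Relation.Binary.PropositionalEquality using (_≡_; _≢_)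
open import Relation.Nullary using (¬_)

data Color : Set where
  c1 c2 c3 : Color

num : Color → ℕ
num c1 = 1
num c2 = 2
num c3 = 3

_==ᶜ_ : Color → Color → Bool
c1 ==ᶜ c1 = true
c2 ==ᶜ c2 = true
c3 ==ᶜ c3 = true
_  ==ᶜ _  = false

ColorSet : Set
ColorSet = Color → Bool

single : Color → ColorSet
single c d = c ==ᶜ d

pair : Color → Color → ColorSet
pair c c' d = (c ==ᶜ d) ∨ (c' ==ᶜ d)

full : ColorSet
full _ = true

-- 3-colored simplicial complexes.
-- nV c = number of vertices of color c; vertex v^c_{i+1} is (c , i : Fin (nV c)).
-- Since no face contains two vertices of the same color, a face is exactly
-- a choice of at most one vertex of each color.

Face : (Color → ℕ) → Set
Face n = (c : Color) → Maybe (Fin (n c))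

mk : {n : Color → ℕ} → Maybe (Fin (n c1)) → Maybe (Fin (n c2)) → Maybe (Fin (n c3)) → Face n
mk a b c c1 = a
mk a b c c2 = b
mk a b c c3 = c

_⊆F_ : {n : Color → ℕ} → Face n → Face n → Set
τ ⊆F σ = ∀ c → (τ c ≡ nothing) ⊎ (τ c ≡ σ c)

vertexFace : {n : Color → ℕ} → (c : Color) → Fin (n c) → Face n
vertexFace c1 i c1 = just i
vertexFace c1 i c2 = nothing
vertexFace c1 i c3 = nothing
vertexFace c2 i c1 = nothing
vertexFace c2 i c2 = just i
vertexFace c2 i c3 = nothing
vertexFace c3 i c1 = nothing
vertexFace c3 i c2 = nothing
vertexFace c3 i c3 = just i

record Complex : Set where
  field
    nV    : Color → ℕ
    face  : Face nV → Bool
    down  : ∀ (σ τ : Face nV) → τ ⊆F σ → T (face σ) → T (face τ)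
    empty : T (face (λ _ → nothing))
    vert  : ∀ c (i : Fin (nV c)) → T (face (vertexFace c i))

hasColorSet : {n : Color → ℕ} → Face n → ColorSet → Bool
hasColorSet φ S = eqB (is-just (φ c1)) (S c1) ∧ (eqB (is-just (φ c2)) (S c2) ∧ eqB (is-just (φ c3)) (S c3))
  where
  eqB : Bool → Bool → Bool
  eqB true b = b
  eqB false b = not b

options : (m : ℕ) → List (Maybe (Fin m))
options m = nothing ∷ map just (allFin m)

fRaw : (n : Color → ℕ) → (Face n → Bool) → ColorSet → ℕ
fRaw n P S =
  sum (map (λ a → sum (map (λ b → sum (map (λ c →
    ind (mk {n} a b c)) (options (n c3)))) (options (n c2)))) (options (n c1)))
  where
  ind : Face n → ℕ
  ind φ = if P φ ∧ hasColorSet φ S then 1 else 0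

f : Complex → ColorSet → ℕ
f Δ S = fRaw (Complex.nV Δ) (Complex.face Δ) S

fV : Complex → Color → ℕ
fV Δ c = f Δ (single c)

fE : Complex → Color → Color → ℕ
fE Δ c d = f Δ (pair c d)

fT : Complex → ℕ
fT Δ = f Δ full

AllPositive : Complex → Set
AllPositive Δ = ∀ S → 0 < f Δ S

-- b_i(Δ) = ⌊ √(a / d) ⌋ is characterised (for d > 0) by k²d ≤ a < (k+1)²d.

IsFloorSqrtDiv : ℕ → ℕ → ℕ → Set
IsFloorSqrtDiv a d k = (k * k * d ≤ a) × (a < suc k * suc k * d)

IsB : Complex → Color → ℕ → Set
IsB Δ c1 k = IsFloorSqrtDiv (fE Δ c1 c2 * fE Δ c1 c3) (fE Δ c2 c3) k
IsB Δ c2 k = IsFloorSqrtDiv (fE Δ c1 c2 * fE Δ c2 c3) (fE Δ c1 c3) k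
IsB Δ c3 k = IsFloorSqrtDiv (fE Δ c1 c3 * fE Δ c2 c3) (fE Δ c1 c2) k

-- Graphs on colored vertices; vertex v^c_{i+1} has
-- index i (only indices i < n c are vertices).  The complex is the clique
-- complex (empty set, vertices, edges, pairwise adjacent triples).

record Graph : Set where
  field
    n   : Color → ℕ
    adj : Color → ℕ → Color → ℕ → Bool

clique : (G : Graph) → Face (Graph.n G) → Bool
clique G φ = ok c1 c2 ∧ (ok c1 c3 ∧ ok c2 c3)
  where
  ok : Color → Color → Bool
  ok c d with φ c | φ d
  ... | just i | just j = Graph.adj G c (toℕ i) d (toℕ j)
  ... | _      | _      = true

fG : Graph → ColorSet → ℕ
fG G S = fRaw (Graph.n G) (clique G) S

edges : Graph → Color → Color → ℕ
edges G p c = fG G (pair p c)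

stage0 : (Color → ℕ) → Graph
stage0 g = record { n = g ; adj = λ c i d j → not (c ==ᶜ d) }

-- k_c: largest k ≤ (number of present vertices of color c) such that
-- edges_{pc} + k ≤ f_{pc}(Δ)   (meaningful when edges_{pc} ≤ f_{pc}(Δ))
kk : Complex → Graph → Color → Color → ℕ
kk Δ G p c = Graph.n G c ⊓ (fE Δ p c ∸ edges G p c)

-- add v^p_{n_p + 1} joined to the first k_c vertices of each color c ≠ p
step : Complex → Graph → Color → Graph
step Δ G p = record
  { n   = λ c → if c ==ᶜ p then suc (Graph.n G c) else Graph.n G c
  ; adj = λ c i d j →
      if isNew c i then (not (d ==ᶜ p) ∧ (j <ᵇ kk Δ G p d))
      else if isNew d j then (not (c ==ᶜ p) ∧ (i <ᵇ kk Δ G p c))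
      else Graph.adj G c i d j
  }
  where
  isNew : Color → ℕ → Bool
  isNew c i = (c ==ᶜ p) ∧ (i ≡ᵇ Graph.n G p)

record Params : Set where
  field
    g    : Color → ℕ
    gpos : ∀ c → 0 < g c
    p    : Color
    q    : Color
    p≢q  : p ≢ q

module _ (Δ : Complex) (P : Params) where
  open Params P

  addP : Bool
  addP = g p <ᵇ fV Δ p

  addQ : Bool
  addQ = g q <ᵇ fV Δ q

  G0 : Graph
  G0 = stage0 g

  G1 : Graph
  G1 = if addP then step Δ G0 p else G0

  G2 : Graph
  G2 = if addQ then step Δ G1 q else G1

  -- the construction is well defined (each k_c exists)
  WellDefined : Set
  WellDefined =
    (T addP → ∀ c → c ≢ p → edges G0 p c ≤ fE Δ p c) ×
    (T addQ → ∀ c → c ≢ q → edges G1 q c ≤ fE Δ q c)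

  fΓ : ColorSet → ℕ
  fΓ S = fG G2 S

  fΓT : ℕ
  fΓT = fΓ full

  edgeSumΓ : ℕ
  edgeSumΓ = fΓ (pair c1 c2) + fΓ (pair c1 c3) + fΓ (pair c2 c3)

r : Params → ℕ
r P = 6 ∸ (num (Params.p P) + num (Params.q P))

gP : Params → Color → ℕ
gP P = Params.g P

edgeSum : Complex → ℕ
edgeSum Δ = fE Δ c1 c2 + fE Δ c1 c3 + fE Δ c2 c3

min3 : ℕ → ℕ → ℕ → ℕ
min3 a b c = a ⊓ (b ⊓ c)

InA : Complex → Params → Set
InA Δ P = WellDefined Δ P × (∀ (S : ColorSet) → ¬ (∀ c → S c ≡ true) → fΓ Δ P S ≤ f Δ S)

InB : Complex → Params → Set
InB Δ P = InA Δ P × (∀ P' → InA Δ P' → fΓT Δ P' ≤ fΓT Δ P)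

InC : Complex → Params → Set
InC Δ P = InB Δ P × (∀ P' → InB Δ P' → edgeSumΓ Δ P' ≤ edgeSumΓ Δ P)

InD : Complex → Params → Set
InD Δ P = InC Δ P ×
  (fΓT Δ P < min3 (fV Δ c1 * fE Δ c2 c3) (fV Δ c2 * fE Δ c1 c3) (fV Δ c3 * fE Δ c1 c2))

InF : Complex → Params → Set
InF Δ P = InA Δ P × (edgeSumΓ Δ P ≡ edgeSum Δ) × (∃ λ P' → InD Δ P') ×
  (∃ λ i → IsB Δ i (Params.g P i))

-- With r = 2 the construction adds at most one vertex to each of the colours 1 and 3, so a member
-- of 𝓕 with parameters g = (B, y, z) and the edge numbers of Δ satisfies
--   B y ≤ f₁₂ ≤ (B+1) y,   B z ≤ f₁₃ ≤ (B+1)(z+1),   y z ≤ f₂₃ ≤ y (z+1).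
-- For g₂(Γ₁) < x < g₂(Γ₂) take z = ⌊f₂₃ / x⌋. Comparing x z ≤ f₂₃ ≤ x (z+1) with these bounds for Γ₁
-- and Γ₂ (whose g₁ agree, both being b₁) shows that (B, x, z) obeys the same three sandwiches and that
-- B < f₁ and z < f₃, so with p = 1, q = 3 both extra vertices are added, and each one is joined to
-- exactly as many vertices as edges are still missing. The condition 𝒟(Δ) ≠ ∅ is inherited from Γ₁.

module Submission where

open import Defs

module Interpolation where

  open import Data.Bool using (Bool; true; false; _∧_; not; if_then_else_; T)
  open import Data.Bool.Properties using (∧-identityʳ; ∧-zeroʳ)
  open import Data.Empty using (⊥-elim)
  open import Data.Fin using (Fin; toℕ)
  open import Data.List using (List; []; _∷_; map; allFin; tabulate)
  open import Data.List.Properties using (map-cong; map-tabulate; map-∘)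
  open import Data.Maybe using (Maybe; just; nothing; is-just)
  open import Data.Nat
  open import Data.Nat.DivMod using (_/_; _%_; m/n*n≤m; m≡m%n+[m/n]*n; m%n<n)
  open import Data.Nat.ListAction using (sum)
  open import Data.Nat.Properties
  open import Data.Nat.Solver using (module +-*-Solver)
  open import Data.Product using (∃; _×_; _,_; proj₁; proj₂)
  open import Data.Sum using (inj₁; inj₂)
  open import Function using (_∘_; id; case_of_)
  open import Relation.Binary.PropositionalEquality
  open import Relation.Nullary using (¬_)
  open +-*-Solver using (solve; _:=_; _:+_; _:*_; con)
  open import Algebra.Properties.CommutativeSemigroup +-commutativeSemigroup using (interchange)

  𝟙 : Bool → ℕ
  𝟙 b = if b then 1 else 0

  ∑< : ℕ → (ℕ → ℕ) → ℕ
  ∑< zero    h = 0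
  ∑< (suc m) h = h 0 + ∑< m (h ∘ suc)

  ∑<-cong : ∀ m {h h′ : ℕ → ℕ} → (∀ i → i < m → h i ≡ h′ i) → ∑< m h ≡ ∑< m h′
  ∑<-cong zero    e = refl
  ∑<-cong (suc m) e = cong₂ _+_ (e 0 z<s) (∑<-cong m (λ i i<m → e (suc i) (s<s i<m)))

  ∑<-const : ∀ m k → ∑< m (λ _ → k) ≡ m * k
  ∑<-const zero    k = refl
  ∑<-const (suc m) k = cong (k +_) (∑<-const m k)

  ∑<-1 : ∀ m → ∑< m (λ _ → 1) ≡ m
  ∑<-1 m = trans (∑<-const m 1) (*-identityʳ m)

  ∑<-snoc : ∀ m h → ∑< (suc m) h ≡ ∑< m h + h m
  ∑<-snoc zero    h = +-identityʳ (h 0)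
  ∑<-snoc (suc m) h = trans (cong (h 0 +_) (∑<-snoc m (h ∘ suc))) (sym (+-assoc (h 0) _ _))

  ∑<-+ : ∀ m (h h′ : ℕ → ℕ) → ∑< m (λ i → h i + h′ i) ≡ ∑< m h + ∑< m h′
  ∑<-+ zero    h h′ = refl
  ∑<-+ (suc m) h h′ = trans (cong (h 0 + h′ 0 +_) (∑<-+ m (h ∘ suc) (h′ ∘ suc))) (interchange (h 0) (h′ 0) _ _)

  ∑<-<ᵇ : ∀ m k → ∑< m (λ j → 𝟙 (j <ᵇ k)) ≡ m ⊓ k
  ∑<-<ᵇ zero    k       = refl
  ∑<-<ᵇ (suc m) zero    = trans (∑<-const m 0) (*-zeroʳ m)
  ∑<-<ᵇ (suc m) (suc k) = cong suc (∑<-<ᵇ m k)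

  ∑<-≤ : ∀ m k (h : ℕ → ℕ) → (∀ i → h i ≤ k) → ∑< m h ≤ m * k
  ∑<-≤ zero    k h le = z≤n
  ∑<-≤ (suc m) k h le = +-mono-≤ (le 0) (∑<-≤ m k (h ∘ suc) (le ∘ suc))

  ≡ᵇ-refl : ∀ n → (n ≡ᵇ n) ≡ true
  ≡ᵇ-refl zero    = refl
  ≡ᵇ-refl (suc n) = ≡ᵇ-refl n

  <⇒≡ᵇ-false : ∀ {i n} → i < n → (i ≡ᵇ n) ≡ false
  <⇒≡ᵇ-false {zero}  {suc n} _         = refl
  <⇒≡ᵇ-false {suc i} {suc n} (s<s i<n) = <⇒≡ᵇ-false i<n

  ∑<²-addRow : ∀ n₁ n₂ (A : ℕ → ℕ → Bool) K → K ≤ n₂ →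
    (∑< (suc n₁) λ i → ∑< n₂ λ j → 𝟙 (if i ≡ᵇ n₁ then j <ᵇ K else A i j)) ≡ (∑< n₁ λ i → ∑< n₂ λ j → 𝟙 (A i j)) + K
  ∑<²-addRow n₁ n₂ A K K≤n₂ = trans (∑<-snoc n₁ _) (cong₂ _+_
    (∑<-cong n₁ λ i i<n₁ → cong (λ t → ∑< n₂ λ j → 𝟙 (if t then j <ᵇ K else A i j)) (<⇒≡ᵇ-false i<n₁))
    (trans (cong (λ t → ∑< n₂ λ j → 𝟙 (if t then j <ᵇ K else A n₁ j)) (≡ᵇ-refl n₁))
      (trans (∑<-<ᵇ n₂ K) (m≥n⇒m⊓n≡n K≤n₂))))

  ∑<²-addColumn : ∀ n₁ n₂ (A : ℕ → ℕ → Bool) K → K ≤ n₁ →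
    (∑< n₁ λ i → ∑< (suc n₂) λ j → 𝟙 (if j ≡ᵇ n₂ then i <ᵇ K else A i j)) ≡ (∑< n₁ λ i → ∑< n₂ λ j → 𝟙 (A i j)) + K
  ∑<²-addColumn n₁ n₂ A K K≤n₁ = begin
    (∑< n₁ λ i → ∑< (suc n₂) λ j → 𝟙 (if j ≡ᵇ n₂ then i <ᵇ K else A i j))
      ≡⟨ ∑<-cong n₁ (λ i _ → trans (∑<-snoc n₂ _) (cong₂ _+_
           (∑<-cong n₂ λ j j<n₂ → cong (λ t → 𝟙 (if t then i <ᵇ K else A i j)) (<⇒≡ᵇ-false j<n₂))
           (cong (λ t → 𝟙 (if t then i <ᵇ K else A i n₂)) (≡ᵇ-refl n₂)))) ⟩
    (∑< n₁ λ i → (∑< n₂ λ j → 𝟙 (A i j)) + 𝟙 (i <ᵇ K))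
      ≡⟨ ∑<-+ n₁ _ _ ⟩
    (∑< n₁ λ i → ∑< n₂ λ j → 𝟙 (A i j)) + ∑< n₁ (λ i → 𝟙 (i <ᵇ K))
      ≡⟨ cong (_ +_) (trans (∑<-<ᵇ n₁ K) (m≥n⇒m⊓n≡n K≤n₁)) ⟩
    (∑< n₁ λ i → ∑< n₂ λ j → 𝟙 (A i j)) + K ∎
    where open ≡-Reasoning

  sum-tabulate-toℕ : ∀ m (h : ℕ → ℕ) → sum (tabulate (h ∘ toℕ {m})) ≡ ∑< m h
  sum-tabulate-toℕ zero    h = refl
  sum-tabulate-toℕ (suc m) h = cong (h 0 +_) (sum-tabulate-toℕ m (h ∘ suc))

  sum-allFin : ∀ m (h : ℕ → ℕ) → sum (map (h ∘ toℕ) (allFin m)) ≡ ∑< m h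
  sum-allFin m h = trans (cong sum (map-tabulate {n = m} id (h ∘ toℕ))) (sum-tabulate-toℕ m h)

  sum-map-zero : ∀ {A : Set} (xs : List A) → sum (map (λ _ → 0) xs) ≡ 0
  sum-map-zero []       = refl
  sum-map-zero (_ ∷ xs) = sum-map-zero xs

  sum-map-if : ∀ {A : Set} m (h : A → ℕ) xs → sum (map (λ y → if m then h y else 0) xs) ≡ (if m then sum (map h xs) else 0)
  sum-map-if true  h xs = refl
  sum-map-if false h xs = sum-map-zero xs

  -- An entry of a face in some colour counts towards S iff it is present exactly when the colour
  -- lies in S; an absent entry is placed at the junk position 0.
  fits : {m : ℕ} → Bool → Maybe (Fin m) → Bool
  fits s a = if is-just a then s else not s

  position : {m : ℕ} → Maybe (Fin m) → ℕ
  position nothing  = 0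
  position (just i) = toℕ i

  ∑? : Bool → ℕ → (ℕ → ℕ) → ℕ
  ∑? true  m h = ∑< m h
  ∑? false _ h = h 0

  sum-options : ∀ s m (F : ℕ → ℕ) → sum (map (λ a → if fits s a then F (position a) else 0) (options m)) ≡ ∑? s m F
  sum-options true  m F = trans (sym (cong sum (map-∘ (allFin m)))) (sum-allFin m F)
  sum-options false m F = trans (cong (F 0 +_) (trans (sym (cong sum (map-∘ (allFin m)))) (sum-map-zero (allFin m)))) (+-identityʳ (F 0))

  hasColorSet-mk : ∀ {n} a b c S → hasColorSet (mk {n} a b c) S ≡ fits (S c1) a ∧ (fits (S c2) b ∧ fits (S c3) c)
  hasColorSet-mk nothing  nothing  nothing  S = refl
  hasColorSet-mk nothing  nothing  (just _) S = refl
  hasColorSet-mk nothing  (just _) nothing  S = refl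
  hasColorSet-mk nothing  (just _) (just _) S = refl
  hasColorSet-mk (just _) nothing  nothing  S = refl
  hasColorSet-mk (just _) nothing  (just _) S = refl
  hasColorSet-mk (just _) (just _) nothing  S = refl
  hasColorSet-mk (just _) (just _) (just _) S = refl

  adjacentIf : Bool → Bool → Bool → Bool
  adjacentIf true true e = e
  adjacentIf _    _    _ = true

  cliqueAt : Graph → Bool → Bool → Bool → ℕ → ℕ → ℕ → Bool
  cliqueAt G s₁ s₂ s₃ i j k =
    adjacentIf s₁ s₂ (A c1 i c2 j) ∧ (adjacentIf s₁ s₃ (A c1 i c3 k) ∧ adjacentIf s₂ s₃ (A c2 j c3 k))
    where A = Graph.adj G

  clique-mk : ∀ G a b c → clique G (mk a b c) ≡ cliqueAt G (is-just a) (is-just b) (is-just c) (position a) (position b) (position c)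
  clique-mk G nothing  nothing  nothing  = refl
  clique-mk G nothing  nothing  (just _) = refl
  clique-mk G nothing  (just _) nothing  = refl
  clique-mk G nothing  (just _) (just _) = refl
  clique-mk G (just _) nothing  nothing  = refl
  clique-mk G (just _) nothing  (just _) = refl
  clique-mk G (just _) (just _) nothing  = refl
  clique-mk G (just _) (just _) (just _) = refl

  𝟙-∧-gated : ∀ x m₁ m₂ m₃ → 𝟙 (x ∧ (m₁ ∧ (m₂ ∧ m₃))) ≡ (if m₁ then (if m₂ then (if m₃ then 𝟙 x else 0) else 0) else 0)
  𝟙-∧-gated x true  true  true  = cong 𝟙 (∧-identityʳ x)
  𝟙-∧-gated x true  true  false = cong 𝟙 (∧-zeroʳ x)
  𝟙-∧-gated x true  false _     = cong 𝟙 (∧-zeroʳ x)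
  𝟙-∧-gated x false _     _     = cong 𝟙 (∧-zeroʳ x)

  if-fits : ∀ {m} s (a : Maybe (Fin m)) (F : Bool → ℕ) → (if fits s a then F (is-just a) else 0) ≡ (if fits s a then F s else 0)
  if-fits true  (just _) F = refl
  if-fits true  nothing  F = refl
  if-fits false (just _) F = refl
  if-fits false nothing  F = refl

  module _ (G : Graph) (S : ColorSet) where
    private
      n : Color → ℕ
      n = Graph.n G
      w : ℕ → ℕ → ℕ → ℕ
      w = λ i j k → 𝟙 (cliqueAt G (S c1) (S c2) (S c3) i j k)

    𝟙-face-gated : ∀ a b c →
      𝟙 (clique G (mk {n} a b c) ∧ hasColorSet (mk {n} a b c) S) ≡
      (if fits (S c1) a then (if fits (S c2) b then (if fits (S c3) c then w (position a) (position b) (position c) else 0) else 0) else 0)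
    𝟙-face-gated a b c = begin
      𝟙 (clique G (mk {n} a b c) ∧ hasColorSet (mk {n} a b c) S)
        ≡⟨ cong₂ (λ x m → 𝟙 (x ∧ m)) (clique-mk G a b c) (hasColorSet-mk {n} a b c S) ⟩
      𝟙 (cliqueAt G (is-just a) (is-just b) (is-just c) i j k ∧ (fits s₁ a ∧ (fits s₂ b ∧ fits s₃ c)))
        ≡⟨ 𝟙-∧-gated _ (fits s₁ a) (fits s₂ b) (fits s₃ c) ⟩
      (if fits s₁ a then (if fits s₂ b then (if fits s₃ c then 𝟙 (cliqueAt G (is-just a) (is-just b) (is-just c) i j k) else 0) else 0) else 0)
        ≡⟨ if-fits s₁ a (λ t → if fits s₂ b then (if fits s₃ c then 𝟙 (cliqueAt G t (is-just b) (is-just c) i j k) else 0) else 0) ⟩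
      (if fits s₁ a then (if fits s₂ b then (if fits s₃ c then 𝟙 (cliqueAt G s₁ (is-just b) (is-just c) i j k) else 0) else 0) else 0)
        ≡⟨ cong (λ v → if fits s₁ a then v else 0) (if-fits s₂ b (λ t → if fits s₃ c then 𝟙 (cliqueAt G s₁ t (is-just c) i j k) else 0)) ⟩
      (if fits s₁ a then (if fits s₂ b then (if fits s₃ c then 𝟙 (cliqueAt G s₁ s₂ (is-just c) i j k) else 0) else 0) else 0)
        ≡⟨ cong (λ v → if fits s₁ a then (if fits s₂ b then v else 0) else 0) (if-fits s₃ c (λ t → 𝟙 (cliqueAt G s₁ s₂ t i j k))) ⟩
      (if fits s₁ a then (if fits s₂ b then (if fits s₃ c then w i j k else 0) else 0) else 0) ∎
      where
      open ≡-Reasoning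
      s₁ = S c1
      s₂ = S c2
      s₃ = S c3
      i = position a
      j = position b
      k = position c

    fG-∑ : fG G S ≡ ∑? (S c1) (n c1) λ i → ∑? (S c2) (n c2) λ j → ∑? (S c3) (n c3) λ k → 𝟙 (cliqueAt G (S c1) (S c2) (S c3) i j k)
    fG-∑ = begin
      fG G S
        ≡⟨ sum-cong (options (n c1)) (λ a → sum-cong (options (n c2)) (λ b → sum-cong (options (n c3)) (𝟙-face-gated a b))) ⟩
      sum (map (λ a → sum (map (λ b → sum (map (λ c → gate₁ a (gate₂ b (gate₃ c (w (position a) (position b) (position c))))) (options (n c3)))) (options (n c2)))) (options (n c1)))
        ≡⟨ sum-cong (options (n c1)) (λ a → sum-cong (options (n c2)) (λ b →
             trans (sum-map-if (fits (S c1) a) (λ c → gate₂ b (gate₃ c (w (position a) (position b) (position c)))) (options (n c3)))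
               (cong (gate₁ a) (trans (sum-map-if (fits (S c2) b) (λ c → gate₃ c (w (position a) (position b) (position c))) (options (n c3)))
               (cong (gate₂ b) (sum-options (S c3) (n c3) _)))))) ⟩
      sum (map (λ a → sum (map (λ b → gate₁ a (gate₂ b (∑? (S c3) (n c3) (w (position a) (position b))))) (options (n c2)))) (options (n c1)))
        ≡⟨ sum-cong (options (n c1)) (λ a → trans (sum-map-if (fits (S c1) a) (λ b → gate₂ b (∑? (S c3) (n c3) (w (position a) (position b)))) (options (n c2)))
                                                  (cong (gate₁ a) (sum-options (S c2) (n c2) _))) ⟩
      sum (map (λ a → gate₁ a (∑? (S c2) (n c2) λ j → ∑? (S c3) (n c3) (w (position a) j))) (options (n c1)))
        ≡⟨ sum-options (S c1) (n c1) _ ⟩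
      (∑? (S c1) (n c1) λ i → ∑? (S c2) (n c2) λ j → ∑? (S c3) (n c3) λ k → w i j k) ∎
      where
      open ≡-Reasoning
      gate₁ : Maybe (Fin (n c1)) → ℕ → ℕ
      gate₁ a v = if fits (S c1) a then v else 0
      gate₂ : Maybe (Fin (n c2)) → ℕ → ℕ
      gate₂ b v = if fits (S c2) b then v else 0
      gate₃ : Maybe (Fin (n c3)) → ℕ → ℕ
      gate₃ c v = if fits (S c3) c then v else 0
      sum-cong : ∀ {A : Set} {h h′ : A → ℕ} xs → (∀ x → h x ≡ h′ x) → sum (map h xs) ≡ sum (map h′ xs)
      sum-cong xs e = cong sum (map-cong e xs)

  E : Graph → Color → Color → ℕ
  E G c d = ∑< (Graph.n G c) λ i → ∑< (Graph.n G d) λ j → 𝟙 (Graph.adj G c i d j)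

  module _ (G : Graph) where
    private
      n : Color → ℕ
      n = Graph.n G
      A : Color → ℕ → Color → ℕ → Bool
      A = Graph.adj G

    fG-empty : fG G (λ _ → false) ≡ 1
    fG-empty = fG-∑ G (λ _ → false)

    fG-single : ∀ c → fG G (single c) ≡ n c
    fG-single c1 = trans (fG-∑ G (single c1)) (∑<-1 (n c1))
    fG-single c2 = trans (fG-∑ G (single c2)) (∑<-1 (n c2))
    fG-single c3 = trans (fG-∑ G (single c3)) (∑<-1 (n c3))

    private
      𝟙-∧true : ∀ m m′ (h : ℕ → ℕ → Bool) → (∑< m λ i → ∑< m′ λ j → 𝟙 (h i j ∧ true)) ≡ (∑< m λ i → ∑< m′ λ j → 𝟙 (h i j))
      𝟙-∧true m m′ h = ∑<-cong m (λ i _ → ∑<-cong m′ (λ j _ → cong 𝟙 (∧-identityʳ (h i j))))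

    edges₁₂≡E : edges G c1 c2 ≡ E G c1 c2
    edges₁₂≡E = trans (fG-∑ G (pair c1 c2)) (𝟙-∧true (n c1) (n c2) (λ i j → A c1 i c2 j))

    edges₁₃≡E : edges G c1 c3 ≡ E G c1 c3
    edges₁₃≡E = trans (fG-∑ G (pair c1 c3)) (𝟙-∧true (n c1) (n c3) (λ i k → A c1 i c3 k))

    edges₂₃≡E : edges G c2 c3 ≡ E G c2 c3
    edges₂₃≡E = fG-∑ G (pair c2 c3)

  module _ (Δ : Complex) (G : Graph) where
    private
      n : Color → ℕ
      n = Graph.n G
      A : Color → ℕ → Color → ℕ → Bool
      A = Graph.adj G

    E-step₁-c2 : E (step Δ G c1) c1 c2 ≡ E G c1 c2 + kk Δ G c1 c2
    E-step₁-c2 = ∑<²-addRow (n c1) (n c2) (λ i j → A c1 i c2 j) _ (m⊓n≤m (n c2) _)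

    E-step₁-c3 : E (step Δ G c1) c1 c3 ≡ E G c1 c3 + kk Δ G c1 c3
    E-step₁-c3 = ∑<²-addRow (n c1) (n c3) (λ i j → A c1 i c3 j) _ (m⊓n≤m (n c3) _)

    E-step₃-c1 : E (step Δ G c3) c1 c3 ≡ E G c1 c3 + kk Δ G c3 c1
    E-step₃-c1 = ∑<²-addColumn (n c1) (n c3) (λ i j → A c1 i c3 j) _ (m⊓n≤m (n c1) _)

    E-step₃-c2 : E (step Δ G c3) c2 c3 ≡ E G c2 c3 + kk Δ G c3 c2
    E-step₃-c2 = ∑<²-addColumn (n c2) (n c3) (λ i j → A c2 i c3 j) _ (m⊓n≤m (n c2) _)

  E-stage0 : ∀ g c d → (c ==ᶜ d) ≡ false → E (stage0 g) c d ≡ g c * g d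
  E-stage0 g c d c≠d rewrite c≠d = trans (∑<-const (g c) _) (cong (g c *_) (∑<-1 (g d)))

  E-≤ : ∀ G c d → E G c d ≤ Graph.n G c * Graph.n G d
  E-≤ G c d = ∑<-≤ (Graph.n G c) (Graph.n G d) _ λ i →
    ≤-trans (∑<-≤ (Graph.n G d) 1 _ (λ j → 𝟙≤1 (Graph.adj G c i d j))) (≤-reflexive (*-identityʳ _))
    where
    𝟙≤1 : ∀ b → 𝟙 b ≤ 1
    𝟙≤1 true  = ≤-refl
    𝟙≤1 false = z≤n

  if-elim : ∀ {A : Set} (P : A → Set) b {x y : A} → P x → P y → P (if b then x else y)
  if-elim P true  px _  = px
  if-elim P false _  py = py

  -- What both construction steps preserve when only colours 1 and 3 may receive a new vertex.
  record Grown (g : Color → ℕ) (G : Graph) : Set where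
    field
      n₂≡  : Graph.n G c2 ≡ g c2
      n₃≥  : g c3 ≤ Graph.n G c3
      E₁₂≥ : g c1 * g c2 ≤ E G c1 c2
      E₁₃≥ : g c1 * g c3 ≤ E G c1 c3
      E₂₃≥ : g c2 * g c3 ≤ E G c2 c3

  grown-stage0 : ∀ g → Grown g (stage0 g)
  grown-stage0 g = record
    { n₂≡  = refl
    ; n₃≥  = ≤-refl
    ; E₁₂≥ = ≤-reflexive (sym (E-stage0 g c1 c2 refl))
    ; E₁₃≥ = ≤-reflexive (sym (E-stage0 g c1 c3 refl))
    ; E₂₃≥ = ≤-reflexive (sym (E-stage0 g c2 c3 refl))
    }

  grown-step₁ : ∀ Δ {g G} → Grown g G → Grown g (step Δ G c1)
  grown-step₁ Δ {G = G} gr = record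
    { n₂≡  = n₂≡
    ; n₃≥  = n₃≥
    ; E₁₂≥ = ≤-trans E₁₂≥ (≤-trans (m≤m+n _ _) (≤-reflexive (sym (E-step₁-c2 Δ G))))
    ; E₁₃≥ = ≤-trans E₁₃≥ (≤-trans (m≤m+n _ _) (≤-reflexive (sym (E-step₁-c3 Δ G))))
    ; E₂₃≥ = E₂₃≥
    }
    where open Grown gr

  grown-step₃ : ∀ Δ {g G} → Grown g G → Grown g (step Δ G c3)
  grown-step₃ Δ {G = G} gr = record
    { n₂≡  = n₂≡
    ; n₃≥  = ≤-trans n₃≥ (n≤1+n _)
    ; E₁₂≥ = E₁₂≥
    ; E₁₃≥ = ≤-trans E₁₃≥ (≤-trans (m≤m+n _ _) (≤-reflexive (sym (E-step₃-c1 Δ G))))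
    ; E₂₃≥ = ≤-trans E₂₃≥ (≤-trans (m≤m+n _ _) (≤-reflexive (sym (E-step₃-c2 Δ G))))
    }
    where open Grown gr

  record Shape (g : Color → ℕ) (G : Graph) : Set where
    field
      grown : Grown g G
      n₁≤   : Graph.n G c1 ≤ suc (g c1)
      n₃≤   : Graph.n G c3 ≤ suc (g c3)

  shape : ∀ Δ P → r P ≡ 2 → Shape (Params.g P) (G2 Δ P)
  shape Δ P@record { g = g ; p = c1 ; q = c3 } _ = record
    { grown = if-elim (Grown g) (addQ Δ P) (grown-step₃ Δ grown₁) grown₁
    ; n₁≤   = if-elim (λ G → Graph.n G c1 ≤ suc (g c1)) (addQ Δ P) n₁≤ n₁≤
    ; n₃≤   = if-elim (λ G → Graph.n G c3 ≤ suc (g c3)) (addQ Δ P) (s≤s (≤-reflexive n₃≡)) (≤-trans (≤-reflexive n₃≡) (n≤1+n _))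
    }
    where
    grown₁ : Grown g (G1 Δ P)
    grown₁ = if-elim (Grown g) (addP Δ P) (grown-step₁ Δ (grown-stage0 g)) (grown-stage0 g)
    n₁≤ : Graph.n (G1 Δ P) c1 ≤ suc (g c1)
    n₁≤ = if-elim (λ G → Graph.n G c1 ≤ suc (g c1)) (addP Δ P) ≤-refl (n≤1+n _)
    n₃≡ : Graph.n (G1 Δ P) c3 ≡ g c3
    n₃≡ = if-elim (λ G → Graph.n G c3 ≡ g c3) (addP Δ P) refl refl
  shape Δ P@record { g = g ; p = c3 ; q = c1 } _ = record
    { grown = if-elim (Grown g) (addQ Δ P) (grown-step₁ Δ grown₁) grown₁
    ; n₁≤   = if-elim (λ G → Graph.n G c1 ≤ suc (g c1)) (addQ Δ P) (s≤s (≤-reflexive n₁≡)) (≤-trans (≤-reflexive n₁≡) (n≤1+n _))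
    ; n₃≤   = if-elim (λ G → Graph.n G c3 ≤ suc (g c3)) (addQ Δ P) n₃≤ n₃≤
    }
    where
    grown₁ : Grown g (G1 Δ P)
    grown₁ = if-elim (Grown g) (addP Δ P) (grown-step₃ Δ (grown-stage0 g)) (grown-stage0 g)
    n₃≤ : Graph.n (G1 Δ P) c3 ≤ suc (g c3)
    n₃≤ = if-elim (λ G → Graph.n G c3 ≤ suc (g c3)) (addP Δ P) ≤-refl (n≤1+n _)
    n₁≡ : Graph.n (G1 Δ P) c1 ≡ g c1
    n₁≡ = if-elim (λ G → Graph.n G c1 ≡ g c1) (addP Δ P) refl refl
  shape Δ record { p = c2 ; q = c2 ; p≢q = p≢q } _ = ⊥-elim (p≢q refl)
  shape Δ record { p = c1 ; q = c1 } ()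
  shape Δ record { p = c1 ; q = c2 } ()
  shape Δ record { p = c2 ; q = c1 } ()
  shape Δ record { p = c2 ; q = c3 } ()
  shape Δ record { p = c3 ; q = c2 } ()
  shape Δ record { p = c3 ; q = c3 } ()

  ≤₃-sum-≡ : ∀ {a′ b′ c′ a b c} → a′ ≤ a → b′ ≤ b → c′ ≤ c → a′ + b′ + c′ ≡ a + b + c →
    a′ ≡ a × b′ ≡ b × c′ ≡ c
  ≤₃-sum-≡ a′≤a b′≤b c′≤c sum≡ =
    ≤-antisym a′≤a (≮⇒≥ λ a′<a → <-irrefl sum≡ (+-mono-<-≤ (+-mono-<-≤ a′<a b′≤b) c′≤c)) ,
    ≤-antisym b′≤b (≮⇒≥ λ b′<b → <-irrefl sum≡ (+-mono-<-≤ (+-mono-≤-< a′≤a b′<b) c′≤c)) ,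
    ≤-antisym c′≤c (≮⇒≥ λ c′<c → <-irrefl sum≡ (+-mono-≤-< (+-mono-≤ a′≤a b′≤b) c′<c))

  notFull : ∀ {S : ColorSet} c → S c ≡ false → ¬ (∀ d → S d ≡ true)
  notFull c Sc≡false all = case trans (sym Sc≡false) (all c) of λ ()

  -- N₁ and N₃ are the numbers of vertices of colours 1 and 3 in the constructed complex.
  record Profile (Δ : Complex) (g : Color → ℕ) : Set where
    field
      N₁ N₃  : ℕ
      N₁≤    : N₁ ≤ suc (g c1)
      N₃≥    : g c3 ≤ N₃
      N₃≤    : N₃ ≤ suc (g c3)
      N₁≤f₁  : N₁ ≤ fV Δ c1
      g₂≤f₂  : g c2 ≤ fV Δ c2
      N₃≤f₃  : N₃ ≤ fV Δ c3
      f₁₂≥   : g c1 * g c2 ≤ fE Δ c1 c2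
      f₁₂≤   : fE Δ c1 c2 ≤ N₁ * g c2
      f₁₃≥   : g c1 * g c3 ≤ fE Δ c1 c3
      f₁₃≤   : fE Δ c1 c3 ≤ N₁ * N₃
      f₂₃≥   : g c2 * g c3 ≤ fE Δ c2 c3
      f₂₃≤   : fE Δ c2 c3 ≤ g c2 * N₃

  profile : ∀ Δ P → r P ≡ 2 → InA Δ P → edgeSumΓ Δ P ≡ edgeSum Δ → Profile Δ (Params.g P)
  profile Δ P r≡2 (_ , fΓ≤f) exact = record
    { N₁    = n c1
    ; N₃    = n c3
    ; N₁≤   = n₁≤
    ; N₃≥   = n₃≥
    ; N₃≤   = n₃≤
    ; N₁≤f₁ = subst (_≤ fV Δ c1) (fG-single G c1) (fΓ≤f (single c1) (notFull c2 refl))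
    ; g₂≤f₂ = subst (_≤ fV Δ c2) (trans (fG-single G c2) n₂≡) (fΓ≤f (single c2) (notFull c1 refl))
    ; N₃≤f₃ = subst (_≤ fV Δ c3) (fG-single G c3) (fΓ≤f (single c3) (notFull c1 refl))
    ; f₁₂≥  = subst (g c1 * g c2 ≤_) E₁₂ E₁₂≥
    ; f₁₂≤  = subst₂ _≤_ E₁₂ (cong (n c1 *_) n₂≡) (E-≤ G c1 c2)
    ; f₁₃≥  = subst (g c1 * g c3 ≤_) E₁₃ E₁₃≥
    ; f₁₃≤  = subst (_≤ n c1 * n c3) E₁₃ (E-≤ G c1 c3)
    ; f₂₃≥  = subst (g c2 * g c3 ≤_) E₂₃ E₂₃≥
    ; f₂₃≤  = subst₂ _≤_ E₂₃ (cong (_* n c3) n₂≡) (E-≤ G c2 c3)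
    }
    where
    g : Color → ℕ
    g = Params.g P
    G : Graph
    G = G2 Δ P
    n : Color → ℕ
    n = Graph.n G
    open Shape (shape Δ P r≡2)
    open Grown grown
    edges≡ : edges G c1 c2 ≡ fE Δ c1 c2 × edges G c1 c3 ≡ fE Δ c1 c3 × edges G c2 c3 ≡ fE Δ c2 c3
    edges≡ = ≤₃-sum-≡ (fΓ≤f (pair c1 c2) (notFull c3 refl)) (fΓ≤f (pair c1 c3) (notFull c2 refl))
                      (fΓ≤f (pair c2 c3) (notFull c1 refl)) exact
    E₁₂ : E G c1 c2 ≡ fE Δ c1 c2
    E₁₂ = trans (sym (edges₁₂≡E G)) (proj₁ edges≡)
    E₁₃ : E G c1 c3 ≡ fE Δ c1 c3
    E₁₃ = trans (sym (edges₁₃≡E G)) (proj₁ (proj₂ edges≡))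
    E₂₃ : E G c2 c3 ≡ fE Δ c2 c3
    E₂₃ = trans (sym (edges₂₃≡E G)) (proj₂ (proj₂ edges≡))

  m*z≤n*N⇒z<N : ∀ {m n z N} → n < m → 0 < N → m * z ≤ n * N → z < N
  m*z≤n*N⇒z<N {m} {n} {z} {N@(suc _)} n<m _ mz≤nN =
    ≰⇒> λ N≤z → <⇒≱ n<m (*-cancelʳ-≤ m n N (≤-trans (*-monoʳ-≤ m N≤z) mz≤nN))

  quotient : ∀ c x → 0 < x → ∃ λ z → x * z ≤ c × c ≤ x * suc z
  quotient c x@(suc _) _ = c / x , lower , upper
    where
    open ≤-Reasoning
    lower : x * (c / x) ≤ c
    lower = subst (_≤ c) (*-comm (c / x) x) (m/n*n≤m c x)
    upper : c ≤ x * suc (c / x)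
    upper = begin
      c                     ≡⟨ m≡m%n+[m/n]*n c x ⟩
      c % x + (c / x) * x   ≤⟨ +-monoˡ-≤ _ (<⇒≤ (m%n<n c x)) ⟩
      x + (c / x) * x       ≡⟨ cong (x +_) (*-comm (c / x) x) ⟩
      x + x * (c / x)       ≡⟨ sym (*-suc x (c / x)) ⟩
      x * suc (c / x)       ∎

  IsFloorSqrtDiv-unique : ∀ {a d k k′} → IsFloorSqrtDiv a d k → IsFloorSqrtDiv a d k′ → k ≡ k′
  IsFloorSqrtDiv-unique (lo , hi) (lo′ , hi′) = ≤-antisym (below lo hi′) (below lo′ hi)
    where
    below : ∀ {a d k k′} → k * k * d ≤ a → a < suc k′ * suc k′ * d → k ≤ k′
    below {d = d} lo hi = ≮⇒≥ λ k′<k → <⇒≱ hi (≤-trans (*-monoˡ-≤ d (*-mono-≤ k′<k k′<k)) lo)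

  -- The bounds on (B, x, z) under which the construction with p = 1, q = 3 reproduces the edge
  -- numbers of Δ.
  record Realizable (Δ : Complex) (B x z : ℕ) : Set where
    field
      B>0  : 0 < B
      x>0  : 0 < x
      z>0  : 0 < z
      B<f₁ : B < fV Δ c1
      x≤f₂ : x ≤ fV Δ c2
      z<f₃ : z < fV Δ c3
      f₁₂≥ : B * x ≤ fE Δ c1 c2
      f₁₂≤ : fE Δ c1 c2 ≤ suc B * x
      f₁₃≥ : B * z ≤ fE Δ c1 c3
      f₁₃≤ : fE Δ c1 c3 ≤ suc B * suc z
      f₂₃≥ : x * z ≤ fE Δ c2 c3
      f₂₃≤ : fE Δ c2 c3 ≤ x * suc z

  realizable-between : ∀ {Δ g h x} → AllPositive Δ → Profile Δ g → Profile Δ h →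
    h c1 ≡ g c1 → 0 < g c1 → 0 < h c3 → g c2 < x → x < h c2 → ∃ λ z → Realizable Δ (g c1) x z
  realizable-between {Δ} {g} {h} {x} pos Pg Ph h₁≡g₁ B>0 z₂>0 y₁<x x<y₂ = z , record
    { B>0  = B>0
    ; x>0  = ≤-<-trans z≤n y₁<x
    ; z>0  = <-≤-trans z₂>0 z₂≤z
    ; B<f₁ = m*z≤n*N⇒z<N (<-trans y₁<x x<y₂) (pos (single c1)) (begin
        y₂ * B       ≡⟨ *-comm y₂ B ⟩
        B * y₂       ≡⟨ cong (_* y₂) (sym h₁≡g₁) ⟩
        h c1 * y₂    ≤⟨ H.f₁₂≥ ⟩
        a            ≤⟨ G.f₁₂≤ ⟩
        G.N₁ * y₁    ≤⟨ *-monoˡ-≤ y₁ G.N₁≤f₁ ⟩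
        fV Δ c1 * y₁ ≡⟨ *-comm (fV Δ c1) y₁ ⟩
        y₁ * fV Δ c1 ∎)
    ; x≤f₂ = ≤-trans (<⇒≤ x<y₂) H.g₂≤f₂
    ; z<f₃ = m*z≤n*N⇒z<N y₁<x (pos (single c3)) (≤-trans xz≤y₁N₃ (*-monoʳ-≤ y₁ G.N₃≤f₃))
    ; f₁₂≥ = ≤-trans (*-monoʳ-≤ B (<⇒≤ x<y₂)) (subst (λ t → t * y₂ ≤ a) h₁≡g₁ H.f₁₂≥)
    ; f₁₂≤ = ≤-trans G.f₁₂≤ (*-mono-≤ G.N₁≤ (<⇒≤ y₁<x))
    ; f₁₃≥ = ≤-trans (*-monoʳ-≤ B z≤z₁) G.f₁₃≥
    ; f₁₃≤ = ≤-trans H.f₁₃≤ (*-mono-≤ (subst (λ t → H.N₁ ≤ suc t) h₁≡g₁ H.N₁≤) (≤-trans H.N₃≤ (s≤s z₂≤z)))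
    ; f₂₃≥ = xz≤c
    ; f₂₃≤ = c≤x[1+z]
    }
    where
    open ≤-Reasoning
    module G = Profile Pg
    module H = Profile Ph
    B y₁ y₂ a c : ℕ
    B = g c1
    y₁ = g c2
    y₂ = h c2
    a = fE Δ c1 c2
    c = fE Δ c2 c3
    q : ∃ λ z → x * z ≤ c × c ≤ x * suc z
    q = quotient c x (≤-<-trans z≤n y₁<x)
    z : ℕ
    z = proj₁ q
    xz≤c : x * z ≤ c
    xz≤c = proj₁ (proj₂ q)
    c≤x[1+z] : c ≤ x * suc z
    c≤x[1+z] = proj₂ (proj₂ q)
    xz≤y₁N₃ : x * z ≤ y₁ * G.N₃
    xz≤y₁N₃ = ≤-trans xz≤c G.f₂₃≤
    z≤z₁ : z ≤ g c3
    z≤z₁ = ≤-pred (m*z≤n*N⇒z<N y₁<x z<s (≤-trans xz≤y₁N₃ (*-monoʳ-≤ y₁ G.N₃≤)))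
    z₂≤z : h c3 ≤ z
    z₂≤z = ≤-pred (m*z≤n*N⇒z<N x<y₂ z<s (≤-trans H.f₂₃≥ c≤x[1+z]))

  m+k⊓[n∸m]≡n : ∀ {m n} k → m ≤ n → n ≤ k + m → m + k ⊓ (n ∸ m) ≡ n
  m+k⊓[n∸m]≡n {m} {n} k m≤n n≤k+m =
    trans (cong (m +_) (m≥n⇒m⊓n≡n (subst (n ∸ m ≤_) (m+n∸n≡m k m) (∸-monoˡ-≤ m n≤k+m)))) (m+[n∸m]≡n m≤n)

  m+k⊓[n∸m]≤n : ∀ {m n} k → m ≤ n → m + k ⊓ (n ∸ m) ≤ n
  m+k⊓[n∸m]≤n {m} {n} k m≤n = ≤-trans (+-monoʳ-≤ m (m⊓n≤n k (n ∸ m))) (≤-reflexive (m+[n∸m]≡n m≤n))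

  n≤l+[m+k⊓[n∸m]] : ∀ {m n} k l → m ≤ n → n ≤ l + (m + k) → n ≤ l + (m + k ⊓ (n ∸ m))
  n≤l+[m+k⊓[n∸m]] {m} {n} k l m≤n n≤l+m+k with ≤-total k (n ∸ m)
  ... | inj₁ k≤n∸m = subst (λ t → n ≤ l + (m + t)) (sym (m≤n⇒m⊓n≡m k≤n∸m)) n≤l+m+k
  ... | inj₂ n∸m≤k = subst (λ t → n ≤ l + (m + t)) (sym (m≥n⇒m⊓n≡n n∸m≤k))
                       (subst (λ t → n ≤ l + t) (sym (m+[n∸m]≡n m≤n)) (m≤n+m n l))

  if-T : ∀ {A : Set} {b} {x y : A} → T b → (if b then x else y) ≡ x
  if-T {b = true} _ = refl

  colorSet : Bool → Bool → Bool → ColorSet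
  colorSet s₁ s₂ s₃ c1 = s₁
  colorSet s₁ s₂ s₃ c2 = s₂
  colorSet s₁ s₂ s₃ c3 = s₃

  module Construction {Δ : Complex} (pos : AllPositive Δ) {B x z : ℕ} (R : Realizable Δ B x z) where
    open Realizable R

    g : Color → ℕ
    g c1 = B
    g c2 = x
    g c3 = z

    Γ : Params
    Γ = record { g = g ; gpos = λ { c1 → B>0 ; c2 → x>0 ; c3 → z>0 } ; p = c1 ; q = c3 ; p≢q = λ () }

    H₀ H₁ H₂ : Graph
    H₀ = stage0 g
    H₁ = step Δ H₀ c1
    H₂ = step Δ H₁ c3

    G1≡H₁ : G1 Δ Γ ≡ H₁
    G1≡H₁ = if-T (<⇒<ᵇ B<f₁)

    G2≡H₂ : G2 Δ Γ ≡ H₂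
    G2≡H₂ = trans (if-T (<⇒<ᵇ z<f₃)) (cong (λ G → step Δ G c3) G1≡H₁)

    private
      a b c u : ℕ
      a = fE Δ c1 c2
      b = fE Δ c1 c3
      c = fE Δ c2 c3
      u = B * z + z ⊓ (b ∸ B * z)

    E₁₃-H₁ : E H₁ c1 c3 ≡ u
    E₁₃-H₁ = trans (E-step₁-c3 Δ H₀) (cong₂ (λ e e′ → e + z ⊓ (b ∸ e′)) E₀ (trans (edges₁₃≡E H₀) E₀))
      where
      E₀ : E H₀ c1 c3 ≡ B * z
      E₀ = E-stage0 g c1 c3 refl

    u≤b : u ≤ b
    u≤b = m+k⊓[n∸m]≤n z f₁₃≥

    E₁₂-H₂ : E H₂ c1 c2 ≡ a
    E₁₂-H₂ = begin
      E H₂ c1 c2                              ≡⟨ E-step₁-c2 Δ H₀ ⟩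
      E H₀ c1 c2 + x ⊓ (a ∸ edges H₀ c1 c2)   ≡⟨ cong₂ (λ e e′ → e + x ⊓ (a ∸ e′)) E₀ (trans (edges₁₂≡E H₀) E₀) ⟩
      B * x + x ⊓ (a ∸ B * x)                 ≡⟨ m+k⊓[n∸m]≡n x f₁₂≥ f₁₂≤ ⟩
      a                                       ∎
      where
      open ≡-Reasoning
      E₀ : E H₀ c1 c2 ≡ B * x
      E₀ = E-stage0 g c1 c2 refl

    E₁₃-H₂ : E H₂ c1 c3 ≡ b
    E₁₃-H₂ = begin
      E H₂ c1 c3                                   ≡⟨ E-step₃-c1 Δ H₁ ⟩
      E H₁ c1 c3 + suc B ⊓ (b ∸ edges H₁ c1 c3)    ≡⟨ cong₂ (λ e e′ → e + suc B ⊓ (b ∸ e′)) E₁₃-H₁ (trans (edges₁₃≡E H₁) E₁₃-H₁) ⟩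
      u + suc B ⊓ (b ∸ u)                          ≡⟨ m+k⊓[n∸m]≡n (suc B) u≤b b≤[1+B]+u ⟩
      b                                            ∎
      where
      open ≡-Reasoning
      expand-[1+B][1+z] : suc B * suc z ≡ suc B + (B * z + z)
      expand-[1+B][1+z] = solve 2 (λ B z → (con 1 :+ B) :* (con 1 :+ z) := (con 1 :+ B) :+ (B :* z :+ z)) refl B z
      b≤[1+B]+u : b ≤ suc B + u
      b≤[1+B]+u = n≤l+[m+k⊓[n∸m]] z (suc B) f₁₃≥ (≤-trans f₁₃≤ (≤-reflexive expand-[1+B][1+z]))

    E₂₃-H₂ : E H₂ c2 c3 ≡ c
    E₂₃-H₂ = begin
      E H₂ c2 c3                              ≡⟨ E-step₃-c2 Δ H₁ ⟩
      E H₁ c2 c3 + x ⊓ (c ∸ edges H₁ c2 c3)   ≡⟨ cong₂ (λ e e′ → e + x ⊓ (c ∸ e′)) E₀ (trans (edges₂₃≡E H₁) E₀) ⟩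
      x * z + x ⊓ (c ∸ x * z)                 ≡⟨ m+k⊓[n∸m]≡n x f₂₃≥ (≤-trans f₂₃≤ (≤-reflexive (*-suc x z))) ⟩
      c                                       ∎
      where
      open ≡-Reasoning
      E₀ : E H₁ c2 c3 ≡ x * z
      E₀ = E-stage0 g c2 c3 refl

    wellDefined : WellDefined Δ Γ
    wellDefined = (λ _ → H₀-edges) , λ _ → subst (λ G → ∀ d → d ≢ c3 → edges G c3 d ≤ fE Δ c3 d) (sym G1≡H₁) H₁-edges
      where
      H₀-edges : ∀ d → d ≢ c1 → edges H₀ c1 d ≤ fE Δ c1 d
      H₀-edges c1 d≢c1 = ⊥-elim (d≢c1 refl)
      H₀-edges c2 _    = subst (_≤ a) (sym (trans (edges₁₂≡E H₀) (E-stage0 g c1 c2 refl))) f₁₂≥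
      H₀-edges c3 _    = subst (_≤ b) (sym (trans (edges₁₃≡E H₀) (E-stage0 g c1 c3 refl))) f₁₃≥
      H₁-edges : ∀ d → d ≢ c3 → edges H₁ c3 d ≤ fE Δ c3 d
      H₁-edges c1 _    = subst (_≤ b) (sym (trans (edges₁₃≡E H₁) E₁₃-H₁)) u≤b
      H₁-edges c2 _    = subst (_≤ c) (sym (trans (edges₂₃≡E H₁) (E-stage0 g c2 c3 refl))) f₂₃≥
      H₁-edges c3 d≢c3 = ⊥-elim (d≢c3 refl)

    faces≤ : ∀ s₁ s₂ s₃ → ¬ (s₁ ≡ true × s₂ ≡ true × s₃ ≡ true) → fG H₂ (colorSet s₁ s₂ s₃) ≤ f Δ (colorSet s₁ s₂ s₃)
    faces≤ false false false _ = ≤-trans (≤-reflexive (fG-empty H₂)) (pos (colorSet false false false))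
    faces≤ true  false false _ = ≤-trans (≤-reflexive (fG-single H₂ c1)) B<f₁
    faces≤ false true  false _ = ≤-trans (≤-reflexive (fG-single H₂ c2)) x≤f₂
    faces≤ false false true  _ = ≤-trans (≤-reflexive (fG-single H₂ c3)) z<f₃
    faces≤ true  true  false _ = ≤-reflexive (trans (edges₁₂≡E H₂) E₁₂-H₂)
    faces≤ true  false true  _ = ≤-reflexive (trans (edges₁₃≡E H₂) E₁₃-H₂)
    faces≤ false true  true  _ = ≤-reflexive (trans (edges₂₃≡E H₂) E₂₃-H₂)
    faces≤ true  true  true  notFull = ⊥-elim (notFull (refl , refl , refl))

    -- f_S inspects S only at c1, c2, c3, so fG H₂ S and fG H₂ (colorSet (S c1) (S c2) (S c3))
    -- are definitionally equal.
    Γ∈A : InA Δ Γ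
    Γ∈A = wellDefined , λ S S≢full → subst (λ G → fG G S ≤ f Δ S) (sym G2≡H₂)
      (faces≤ (S c1) (S c2) (S c3) λ (e₁ , e₂ , e₃) → S≢full λ { c1 → e₁ ; c2 → e₂ ; c3 → e₃ })

    Γ-exact : edgeSumΓ Δ Γ ≡ edgeSum Δ
    Γ-exact = subst (λ G → fG G (pair c1 c2) + fG G (pair c1 c3) + fG G (pair c2 c3) ≡ edgeSum Δ) (sym G2≡H₂)
      (cong₂ _+_ (cong₂ _+_ (trans (edges₁₂≡E H₂) E₁₂-H₂) (trans (edges₁₃≡E H₂) E₁₃-H₂)) (trans (edges₂₃≡E H₂) E₂₃-H₂))

open import Data.Integer using (ℤ; +_; -[1+_]; _<_; +<+)
open import Data.Nat using (ℕ; _≤_)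
open import Data.Product using (_×_; ∃; _,_; proj₂)
open import Relation.Binary.PropositionalEquality using (_≡_; refl)

open Interpolation using (Realizable; profile; realizable-between; IsFloorSqrtDiv-unique; module Construction)

lemma2p22 : (Δ : Complex) → AllPositive Δ →
    fE Δ c1 c2 ≤ fE Δ c1 c3 → fE Δ c1 c3 ≤ fE Δ c2 c3 →
    (Γ₁ Γ₂ : Params) → InF Δ Γ₁ → InF Δ Γ₂ →
    IsB Δ c1 (gP Γ₁ c1) → IsB Δ c1 (gP Γ₂ c1) →
    r Γ₁ ≡ 2 → r Γ₂ ≡ 2 →
    (x : ℤ) → + gP Γ₁ c2 < x → x < + gP Γ₂ c2 →
    ∃ λ (Γ₃ : Params) → InF Δ Γ₃ × (+ gP Γ₃ c2 ≡ x) × IsB Δ c1 (gP Γ₃ c1) × (r Γ₃ ≡ 2)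
lemma2p22 Δ pos _ _ Γ₁ Γ₂ (Γ₁∈A , Γ₁-exact , 𝒟≠∅ , _) (Γ₂∈A , Γ₂-exact , _ , _) b₁ b₂ r₁ r₂
          (+ x) (+<+ y₁<x) (+<+ x<y₂) =
  Γ , (Γ∈A , Γ-exact , 𝒟≠∅ , c1 , b₁) , refl , b₁ , refl
  where
  realizable : ∃ λ z → Realizable Δ (gP Γ₁ c1) x z
  realizable = realizable-between pos (profile Δ Γ₁ r₁ Γ₁∈A Γ₁-exact) (profile Δ Γ₂ r₂ Γ₂∈A Γ₂-exact)
    (IsFloorSqrtDiv-unique b₂ b₁) (Params.gpos Γ₁ c1) (Params.gpos Γ₂ c3) y₁<x x<y₂
  open Construction pos (proj₂ realizable)
lemma2p22 _ _ _ _ _ _ _ _ _ _ _ _ -[1+ _ ] () _
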